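{- Let $\mathcal{D}$ be a database, $\mathcal{R}$ a rule set, $C=\mathbf{C}(\mathcal{D},\mathcal{R})$, $\delta$ an $\mathcal{R}$-derivation from $\mathcal{D}$, and $\Sigma$ a reduction sequence applicable to $G_\delta$, with $\Sigma(G_\delta)=(\mathrm{V},\mathrm{E},\mathrm{At},\mathrm{L})$. Then: (1) for each $X_{n_0}\in\mathrm{V}$ with parent nodes $X_{n_1},\dots,X_{n_k}$ (all nodes $Y$ with $(Y,X_{n_0})\in\mathrm{E}$), $\mathit{fr}(X_{n_0})=\bigcup_{i=1}^k\mathrm{L}(X_{n_i},X_{n_0})$; (2) for each $(X_m,X_n)\in\mathrm{E}$, $\mathrm{L}(X_m,X_n)\subseteq\mathbf{T}(X_m)$; (3) for each $X_{n_0}\in\mathrm{V}$ with parent nodes $X_{n_1},\dots,X_{n_k}$, $\bigcup_{i=1}^k\mathrm{L}(X_{n_i},X_{n_0})\subseteq\bigcup_{i=1}^k\mathbf{T}(X_{n_i})$.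
   Context: Terms: constants, variables, nulls. An instance is a set of atoms over constants and nulls; a database a finite set of atoms over constants. $\mathbf{T}(\mathcal{X})$ is the set of terms of a set of atoms. A homomorphism between sets of atoms is a term map, identity on constants, sending atoms to atoms. A rule $\rho=\forall\vec x\vec y(\varphi(\vec x,\vec y)\to\exists\vec z\,\psi(\vec y,\vec z))$ has body $\varphi$ and head $\psi$; frontier $\mathit{fr}(\rho)$ = variables in both; a frontier atom is a body atom containing a frontier variable. A rule set is a finite set of rules; $C=\mathbf{C}(\mathcal{D},\mathcal{R})$ = constants of $\mathcal{D}$ or $\mathcal{R}$. An $\mathcal{R}$-derivation from $\mathcal{D}$ is $\delta=\mathcal{D}=\mathcal{I}_0,(\rho_1,h_1,\mathcal{I}_1),\dots,(\rho_n,h_n,\mathcal{I}_n)$ with $\rho_i\in\mathcal{R}$, $h_i$ a homomorphism from $\mathit{body}(\rho_i)$ to $\mathcal{I}_{i-1}$, $\mathcal{I}_i=\mathcal{I}_{i-1}\cup\overline h_i(\mathit{head}(\rho_i))$ with $\overline h_i$ extending $h_i$ by fresh nulls for existential variables. Derivation graph $G_\delta=(\mathrm{V},\mathrm{E},\mathrm{At},\mathrm{L})$: $\mathrm{V}=\{X_0,\dots,X_n\}$, $\mathrm{At}(X_0)=\mathcal{D}$, $\mathrm{At}(X_i)=\mathcal{I}_i\setminus\mathcal{I}_{i-1}$; $(X_i,X_j)\in\mathrm{E}$ iff some atom of $\mathrm{At}(X_i)$ equals $h_j(a)$ for a frontier atom $a$ of $\rho_j$, with $\mathrm{L}(X_i,X_j)=h_j(\mathrm{vars}(a)\cap\mathit{fr}(\rho_j))\setminus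 C$ (collected over such $a$). $\mathbf{T}(X)=\mathbf{T}(\mathrm{At}(X))\cup C$. Reduction operations (changing only arcs and labels): (ar) delete an arc with empty label; (tr) if $(X_i,X_k),(X_j,X_k)\in\mathrm{E}$, $X_i\neq X_j$, $t\in\mathrm{L}(X_i,X_k)\cap\mathrm{L}(X_j,X_k)$, remove $t$ from $\mathrm{L}(X_j,X_k)$; (cr) if $(X_i,X_k),(X_j,X_k)\in\mathrm{E}$ and some $X_\ell$ with $\ell<k$ has $\mathrm{L}(X_i,X_k)\cup\mathrm{L}(X_j,X_k)\subseteq\mathbf{T}(X_\ell)$, replace these two arcs by $(X_\ell,X_k)$ labelled $\mathrm{L}(X_i,X_k)\cup\mathrm{L}(X_j,X_k)$. A reduction sequence is a finite sequence of such operations, applicable if each condition holds when applied. In $\Sigma(G_\delta)$, a node is a source node if it has no incoming arc. The frontier of a node: $\mathit{fr}(X_n)=\emptyset$ if $X_n$ is a source node of $\Sigma(G_\delta)$, and otherwise $\mathit{fr}(X_n)=\overline h_n(\vec y_n)\setminus C$ where $\vec y_n$ are the frontier variables of $\rho_n$ (the rule whose application created $X_n$, so $\mathrm{At}(X_n)=\overline h_n(\mathit{head}(\rho_n))$). -}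

module Defs where

open import Data.Nat using (ℕ; zero; suc; _≤_; _<_)
open import Data.List using (List; _++_; map)
open import Data.List.Membership.Propositional using (_∈_)
open import Data.Product using (Σ; ∃; ∃-syntax; _×_; _,_)
open import Data.Sum using (_⊎_)
open import Data.Empty using (⊥)
open import Relation.Nullary using (¬_)
open import Relation.Binary.PropositionalEquality using (_≡_; _≢_)
open import Relation.Binary.Construct.Closure.ReflexiveTransitive using (Star)

data Term : Set where
  const : ℕ → Term
  var   : ℕ → Term
  null  : ℕ → Term

record Atom : Set where
  constructor atom
  field
    pred : ℕ
    args : List Term
open Atom public

-- Sets of atoms are represented by lists (read up to membership).
AtomSet : Set
AtomSet = List Atom

_∈tA_ : Term → Atom → Set
t ∈tA a = t ∈ args a

_∈T_ : Term → AtomSet → Set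
t ∈T X = ∃[ a ] (a ∈ X × t ∈tA a)

IsDatabase : AtomSet → Set
IsDatabase D = ∀ {a t} → a ∈ D → t ∈tA a → ∃[ c ] (t ≡ const c)

Subst : Set
Subst = ℕ → Term

substT : Subst → Term → Term
substT h (const c) = const c
substT h (var x)   = h x
substT h (null m)  = null m

substA : Subst → Atom → Atom
substA h (atom p ts) = atom p (map (substT h) ts)

-- Rules  ∀x⃗y⃗ (body(x⃗,y⃗) → ∃z⃗ head(y⃗,z⃗))

record Rule : Set where
  constructor rule
  field
    body : AtomSet
    head : AtomSet
open Rule public

IsRuleAtoms : AtomSet → Set
IsRuleAtoms X = ∀ {a m} → a ∈ X → ¬ (null m ∈tA a)

IsRule : Rule → Set
IsRule ρ = IsRuleAtoms (body ρ) × IsRuleAtoms (head ρ)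

RuleSet : Set
RuleSet = List Rule

IsRuleSet : RuleSet → Set
IsRuleSet R = ∀ {ρ} → ρ ∈ R → IsRule ρ

_∈vars_ : ℕ → AtomSet → Set
x ∈vars X = var x ∈T X

IsFrVar : Rule → ℕ → Set
IsFrVar ρ x = x ∈vars body ρ × x ∈vars head ρ

IsExVar : Rule → ℕ → Set
IsExVar ρ z = z ∈vars head ρ × ¬ (z ∈vars body ρ)

IsFrontierAtom : Rule → Atom → Set
IsFrontierAtom ρ a = a ∈ body ρ × ∃[ x ] (var x ∈tA a × IsFrVar ρ x)

InC : AtomSet → RuleSet → ℕ → Set
InC D R c = const c ∈T D ⊎ ∃[ ρ ] (ρ ∈ R × const c ∈T (body ρ ++ head ρ))

NotC : AtomSet → RuleSet → Term → Set
NotC D R t = ¬ (∃[ c ] (t ≡ const c × InC D R c))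

record Step : Set where
  constructor mkStep
  field
    ρ    : Rule
    h    : Subst
    hbar : Subst
open Step public

-- A derivation of length n from a database; step (suc i) is the
-- (i+1)-th application (steps 1..n are relevant, other values unused).
record Derivation : Set where
  constructor mkDerivation
  field
    n    : ℕ
    step : ℕ → Step
open Derivation public

inst : AtomSet → Derivation → ℕ → AtomSet
inst D δ zero    = D
inst D δ (suc i) = inst D δ i ++ map (substA (hbar (step δ (suc i)))) (head (ρ (step δ (suc i))))

ValidStep : RuleSet → AtomSet → Step → Set
ValidStep R I s =
    (ρ s ∈ R)
  × (∀ {a} → a ∈ body (ρ s) → substA (h s) a ∈ I)
  × (∀ {x} → x ∈vars body (ρ s) → hbar s x ≡ h s x)
  × (∀ {z} → IsExVar (ρ s) z → ∃[ m ] (hbar s z ≡ null m × ¬ (null m ∈T I)))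
  × (∀ {z z'} → IsExVar (ρ s) z → IsExVar (ρ s) z' → hbar s z ≡ hbar s z' → z ≡ z')

IsDerivation : AtomSet → RuleSet → Derivation → Set
IsDerivation D R δ = ∀ i → suc i ≤ n δ → ValidStep R (inst D δ i) (step δ (suc i))

At : AtomSet → Derivation → ℕ → Atom → Set
At D δ zero    a = a ∈ D
At D δ (suc i) a = a ∈ inst D δ (suc i) × ¬ (a ∈ inst D δ i)

TN : AtomSet → RuleSet → Derivation → ℕ → Term → Set
TN D R δ i t = (∃[ a ] (At D δ i a × t ∈tA a)) ⊎ (∃[ c ] (t ≡ const c × InC D R c))

-- A graph over the fixed nodes X_0..X_n (with fixed At): arcs and labels.
record Graph : Set₁ where
  constructor mkGraph
  field
    E : ℕ → ℕ → Set
    L : ℕ → ℕ → Term → Set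
open Graph public

Einit : AtomSet → Derivation → ℕ → ℕ → Set
Einit D δ i zero    = ⊥
Einit D δ i (suc j) =
  i ≤ n δ × suc j ≤ n δ ×
  ∃[ a ] (IsFrontierAtom (ρ (step δ (suc j))) a × At D δ i (substA (h (step δ (suc j))) a))

Linit : AtomSet → RuleSet → Derivation → ℕ → ℕ → Term → Set
Linit D R δ i zero    t = ⊥
Linit D R δ i (suc j) t =
  i ≤ n δ × suc j ≤ n δ ×
  ∃[ a ] (IsFrontierAtom (ρ (step δ (suc j))) a × At D δ i (substA (h (step δ (suc j))) a)
          × ∃[ y ] (var y ∈tA a × IsFrVar (ρ (step δ (suc j))) y
                    × t ≡ h (step δ (suc j)) y × NotC D R t))

G : AtomSet → RuleSet → Derivation → Graph
G D R δ = mkGraph (Einit D δ) (Linit D R δ)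

data RedOp (D : AtomSet) (R : RuleSet) (δ : Derivation) : Graph → Graph → Set₁ where
  ar : ∀ {Gr} i k → E Gr i k → (∀ t → ¬ L Gr i k t) →
       RedOp D R δ Gr (mkGraph (λ a b → E Gr a b × ¬ (a ≡ i × b ≡ k)) (L Gr))
  tr : ∀ {Gr} i j k t → E Gr i k → E Gr j k → i ≢ j →
       L Gr i k t → L Gr j k t →
       RedOp D R δ Gr (mkGraph (E Gr) (λ a b u → L Gr a b u × ¬ (a ≡ j × b ≡ k × u ≡ t)))
  cr : ∀ {Gr} i j k ℓ → E Gr i k → E Gr j k → ℓ < k →
       (∀ t → L Gr i k t ⊎ L Gr j k t → TN D R δ ℓ t) →
       RedOp D R δ Gr
         (mkGraph (λ a b → (E Gr a b × ¬ (b ≡ k × (a ≡ i ⊎ a ≡ j))) ⊎ (a ≡ ℓ × b ≡ k))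
                  (λ a b u → (L Gr a b u × ¬ (b ≡ k × (a ≡ i ⊎ a ≡ j)))
                             ⊎ (a ≡ ℓ × b ≡ k × (L Gr i k u ⊎ L Gr j k u))))

-- Σ(G) = G' for some applicable reduction sequence Σ
Reduces : AtomSet → RuleSet → Derivation → Graph → Graph → Set₁
Reduces D R δ = Star (RedOp D R δ)

IsSource : Graph → ℕ → Set
IsSource Gr m = ∀ p → ¬ E Gr p m

FrRule : AtomSet → RuleSet → Derivation → ℕ → Term → Set
FrRule D R δ zero    t = ⊥
FrRule D R δ (suc i) t =
  ∃[ y ] (IsFrVar (ρ (step δ (suc i))) y × t ≡ hbar (step δ (suc i)) y × NotC D R t)

FrNode : AtomSet → RuleSet → Derivation → Graph → ℕ → Term → Set
FrNode D R δ Gr m t = ¬ IsSource Gr m × FrRule D R δ m t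

InLabels : Graph → ℕ → Term → Set
InLabels Gr m t = ∃[ p ] (E Gr p m × L Gr p m t)

-- Every label of G_δ on an arc into X_k is a term h_k(y) ∉ C for a frontier variable y, i.e. a term of
-- fr(X_k). It occurs in the frontier atom of ρ_k through which the arc was drawn, so it is a term of the
-- parent node. Conversely, every term of fr(X_k) arises this way from the node that created the image of a
-- body atom containing y. These three facts survive every reduction operation. (ar) only deletes arcs
-- without labels. (tr) removes a term from one arc only while another arc into the same node still carries
-- it. (cr) moves labels to an arc into the same node whose source X_ℓ is required to contain them.
module Submission where

open import Defs
open import Data.Nat using (zero; suc; _≤_; z≤n)
open import Data.Nat.Properties using (_≟_; ≤-refl; ≤-trans; n≤1+n; m≤n⇒m≤1+n)
open import Data.Product using (∃-syntax; _×_; _,_; proj₁)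
open import Data.Sum using (inj₁; inj₂)
open import Data.List.Properties using (≡-dec)
open import Data.List.Membership.Propositional using (_∈_)
open import Data.List.Membership.Propositional.Properties using (∈-map⁺)
open import Relation.Nullary using (¬_; yes; no)
open import Relation.Nullary.Decidable using (map′; _×-dec_; _⊎-dec_)
open import Relation.Binary.Definitions using (DecidableEquality)
open import Relation.Binary.PropositionalEquality using (_≡_; refl; sym; trans; cong)
open import Relation.Binary.Construct.Closure.ReflexiveTransitive using (ε; _◅_)

_≟ᵗ_ : DecidableEquality Term
const a ≟ᵗ const b = map′ (cong const) (λ { refl → refl }) (a ≟ b)
var a   ≟ᵗ var b   = map′ (cong var) (λ { refl → refl }) (a ≟ b)
null a  ≟ᵗ null b  = map′ (cong null) (λ { refl → refl }) (a ≟ b)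
const _ ≟ᵗ var _   = no λ ()
const _ ≟ᵗ null _  = no λ ()
var _   ≟ᵗ const _ = no λ ()
var _   ≟ᵗ null _  = no λ ()
null _  ≟ᵗ const _ = no λ ()
null _  ≟ᵗ var _   = no λ ()

_≟ᵃ_ : DecidableEquality Atom
atom p ts ≟ᵃ atom q us =
  map′ (λ { (refl , refl) → refl }) (λ { refl → refl , refl }) (p ≟ q ×-dec ≡-dec _≟ᵗ_ ts us)

open import Data.List.Membership.DecPropositional _≟ᵃ_ using (_∈?_)

module _ (D : AtomSet) (R : RuleSet) (δ : Derivation) where

  ∈-inst⇒At : ∀ i {a} → a ∈ inst D δ i → ∃[ p ] (p ≤ i × At D δ p a)
  ∈-inst⇒At zero    a∈ = zero , z≤n , a∈
  ∈-inst⇒At (suc i) {a} a∈ with a ∈? inst D δ i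
  ... | yes a∈ᵢ = let (p , p≤i , at) = ∈-inst⇒At i a∈ᵢ in p , m≤n⇒m≤1+n p≤i , at
  ... | no  a∉ᵢ = suc i , ≤-refl , a∈ , a∉ᵢ

  record WellLabelled (Gr : Graph) : Set where
    field
      frontier⊆labels : ∀ k → k ≤ n δ → ¬ IsSource Gr k → ∀ t → FrRule D R δ k t → InLabels Gr k t
      label⇒frontier  : ∀ p k t → L Gr p k t → FrRule D R δ k t
      label⇒term      : ∀ p k t → L Gr p k t → TN D R δ p t
  open WellLabelled

  G-wellLabelled : IsDerivation D R δ → WellLabelled (G D R δ)
  G-wellLabelled der = record
    { frontier⊆labels = covers ; label⇒frontier = fromFrontier ; label⇒term = inParent }
    where
    covers : ∀ k → k ≤ n δ → ¬ IsSource (G D R δ) k → ∀ t → FrRule D R δ k t → InLabels (G D R δ) k t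
    covers (suc i) k≤n _ t (y , fv@((a , a∈ , y∈a) , _) , t≡h̄y , t∉C)
      with der i k≤n
    ... | _ , h-hom , h̄-extends-h , _ with ∈-inst⇒At i (h-hom a∈)
    ...   | p , p≤i , at =
      p , (p≤n , k≤n , a , fa , at) , (p≤n , k≤n , a , fa , at , y , y∈a , fv , t≡hy , t∉C)
      where
      p≤n  = ≤-trans p≤i (≤-trans (n≤1+n i) k≤n)
      fa   = a∈ , y , y∈a , fv
      t≡hy = trans t≡h̄y (h̄-extends-h (a , a∈ , y∈a))
    fromFrontier : ∀ p k t → Linit D R δ p k t → FrRule D R δ k t
    fromFrontier p (suc j) t (_ , k≤n , _ , _ , _ , y , _ , fv , t≡h , t∉C) =
      let (_ , _ , h̄-extends-h , _) = der j k≤n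
      in y , fv , trans t≡h (sym (h̄-extends-h (proj₁ fv))) , t∉C
    inParent : ∀ p k t → Linit D R δ p k t → TN D R δ p t
    inParent p (suc j) t (_ , _ , atom _ _ , _ , at , y , y∈a , _ , refl , _) =
      inj₁ (_ , at , ∈-map⁺ (substT (h (step δ (suc j)))) y∈a)

  RedOp-wellLabelled : ∀ {G₁ G₂} → RedOp D R δ G₁ G₂ → WellLabelled G₁ → WellLabelled G₂
  RedOp-wellLabelled {G₂ = Gr′} (ar i k _ unlabelled) wl = record
    { frontier⊆labels = covers
    ; label⇒frontier  = label⇒frontier wl
    ; label⇒term      = label⇒term wl
    }
    where
    covers : ∀ k′ → k′ ≤ n δ → ¬ IsSource Gr′ k′ → ∀ t → FrRule D R δ k′ t → InLabels Gr′ k′ t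
    covers k′ k′≤n nonSource t fr
      with frontier⊆labels wl k′ k′≤n (λ src → nonSource λ p (e , _) → src p e) t fr
    ... | p , e , l = p , (e , λ { (refl , refl) → unlabelled t l }) , l
  RedOp-wellLabelled {G₂ = Gr′} (tr i j k t eik _ i≢j lik _) wl = record
    { frontier⊆labels = covers
    ; label⇒frontier  = λ p k′ s (l , _) → label⇒frontier wl p k′ s l
    ; label⇒term      = λ p k′ s (l , _) → label⇒term wl p k′ s l
    }
    where
    covers : ∀ k′ → k′ ≤ n δ → ¬ IsSource Gr′ k′ → ∀ s → FrRule D R δ k′ s → InLabels Gr′ k′ s
    covers k′ k′≤n nonSource s fr with frontier⊆labels wl k′ k′≤n nonSource s fr
    ... | p , e , l with p ≟ j ×-dec k′ ≟ k ×-dec s ≟ᵗ t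
    ...   | yes (refl , refl , refl) = i , eik , lik , λ (i≡j , _) → i≢j i≡j
    ...   | no kept                  = p , e , l , kept
  RedOp-wellLabelled {Gr} {Gr′} (cr i j k ℓ eik ejk _ ⊆Tℓ) wl = record
    { frontier⊆labels = covers ; label⇒frontier = fromFrontier ; label⇒term = inParent }
    where
    covers : ∀ k′ → k′ ≤ n δ → ¬ IsSource Gr′ k′ → ∀ s → FrRule D R δ k′ s → InLabels Gr′ k′ s
    covers k′ k′≤n nonSource s fr with frontier⊆labels wl k′ k′≤n oldNonSource s fr
      where
      oldNonSource : ¬ IsSource Gr k′
      oldNonSource src = nonSource λ { p (inj₁ (e , _)) → src p e ; p (inj₂ (_ , refl)) → src i eik }
    ... | p , e , l with k′ ≟ k ×-dec (p ≟ i ⊎-dec p ≟ j)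
    ...   | yes (refl , inj₁ refl) = ℓ , inj₂ (refl , refl) , inj₂ (refl , refl , inj₁ l)
    ...   | yes (refl , inj₂ refl) = ℓ , inj₂ (refl , refl) , inj₂ (refl , refl , inj₂ l)
    ...   | no kept                = p , inj₁ (e , kept) , inj₁ (l , kept)
    fromFrontier : ∀ p k′ s → L Gr′ p k′ s → FrRule D R δ k′ s
    fromFrontier p k′ s (inj₁ (l , _))             = label⇒frontier wl p k′ s l
    fromFrontier _ _  s (inj₂ (_ , refl , inj₁ l)) = label⇒frontier wl i k s l
    fromFrontier _ _  s (inj₂ (_ , refl , inj₂ l)) = label⇒frontier wl j k s l
    inParent : ∀ p k′ s → L Gr′ p k′ s → TN D R δ p s
    inParent p k′ s (inj₁ (l , _))           = label⇒term wl p k′ s l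
    inParent _ _  s (inj₂ (refl , refl , l)) = ⊆Tℓ s l

  Reduces-wellLabelled : ∀ {G₁ G₂} → Reduces D R δ G₁ G₂ → WellLabelled G₁ → WellLabelled G₂
  Reduces-wellLabelled ε        wl = wl
  Reduces-wellLabelled (r ◅ rs) wl = Reduces-wellLabelled rs (RedOp-wellLabelled r wl)

lemma9 : (D : AtomSet) (R : RuleSet) (δ : Derivation) →
    IsDatabase D → IsRuleSet R → IsDerivation D R δ →
    (G' : Graph) → Reduces D R δ (G D R δ) G' →
    -- (1)
    (∀ n₀ → n₀ ≤ n δ → ∀ t →
       (FrNode D R δ G' n₀ t → InLabels G' n₀ t) × (InLabels G' n₀ t → FrNode D R δ G' n₀ t))
    -- (2)
    × (∀ m k → E G' m k → ∀ t → L G' m k t → TN D R δ m t)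
    -- (3)
    × (∀ n₀ → n₀ ≤ n δ → ∀ t → InLabels G' n₀ t → ∃[ p ] (E G' p n₀ × TN D R δ p t))
lemma9 D R δ _ _ der G' red =
    (λ n₀ n₀≤n t → (λ (nonSource , fr) → frontier⊆labels n₀ n₀≤n nonSource t fr)
                 , (λ (p , e , l) → (λ src → src p e) , label⇒frontier p n₀ t l))
  , (λ m k _ → label⇒term m k)
  , (λ n₀ _ t (p , e , l) → p , e , label⇒term p n₀ t l)
  where open WellLabelled (Reduces-wellLabelled D R δ red (G-wellLabelled D R δ der))
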